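{- Let $w\in S_n$ be a Boolean permutation with reduced decomposition $w=s_{j_1}\cdots s_{j_l}$ ($j_1,\dots,j_l$ pairwise distinct), let $\underline x\in(\{0,1\}^4)^l$ be a mask for $\widetilde{\mathbf w}$ and $I_f=\{i:\underline x_i=(1,1,1,1)\}$; write $\nu=\nu_{I_f}$. For $i\in\{1,\dots,l\}$ let $C(\underline x,i)$ be the condition: $i\in\overleftarrow N_{I_f}$ and either $\underline x_{\nu(i)}=(1,1,0,1)$ or $\underline x_{\nu(i)}=(*,1,*,0)$; and let $\overleftarrow C(\underline x,i)$ be the condition: there exists $r\in\overrightarrow N_{I_f}$ with $\nu(r)=i$ and either $\underline x_r=(1,0,1,1)$ or $\underline x_r=(*,*,1,0)$. Then for all $i=1,\dots,l$: (1) $\pi_{4i-4}(\underline x)\alpha_{2j_i}>0$; (2) $\pi_{4i-3}(\underline x)\alpha_{2j_i-1}<0$ iff $\underline x_{i,1}=0$ and $\overleftarrow C(\underline x,i)$ holds; (3) $\pi_{4i-2}(\underline x)\alpha_{2j_i+1}<0$ iff $\underline x_{i,1}=0$ and $C(\underline x,i)$ holds; (4) $\pi_{4i-1}(\underline x)\alpha_{2j_i}<0$ iff exactly one of the following holds: $\underline x_i=(1,0,0,*)$; $\underline x_i=(1,0,1,*)$ and $C(\underline x,i)$; $\underline x_i=(1,1,0,*)$ and $\overleftarrow C(\underline x,i)$.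
   Context: $S_m$ symmetric group, $s_i=(i,i+1)$, $\alpha_i=e_i-e_{i+1}$ simple roots; for $y\in S_m$, $y(e_a-e_b)=e_{y(a)}-e_{y(b)}$, positive iff $y(a)<y(b)$. Boolean permutation: product of distinct simple reflections. Doubling map $\widetilde x(2i)=2x(i)$, $\widetilde x(2i-1)=2x(i)-1$. The word $\widetilde{\mathbf w}$ is the concatenation over $i=1,\dots,l$ of the blocks $s_{2j_i}\,s_{2j_i-1}\,s_{2j_i+1}\,s_{2j_i}$. A mask is $\underline x=(\underline x_{i,k})\in(\{0,1\}^4)^l$, $\underline x_i=(\underline x_{i,1},\dots,\underline x_{i,4})$, $\underline x_{i,k}$ attached to the $k$-th letter of block $i$ (position $4(i-1)+k$); a $*$ in a pattern means an arbitrary entry. $\pi_p(\underline x)$ is the product, in order, of those letters among the first $p$ with mask entry $1$. Neighbor sets: for $A\subset\{1,\dots,l\}$, $\overrightarrow N_A$ (resp. $\overleftarrow N_A$) is the set of $i\notin A$ for which there exist $t>0$ and indices $i<i_1<\dots<i_t$ (resp. $i>i_1>\dots>i_t$) with $\{i_1,\dots,i_{t-1}\}\subset A$, $i_t\notin A$, $j_{i_k}=j_i+k$ ($k=1,\dots,t$); $N_A=\overrightarrow N_A\cup\overleftarrow N_A$ and $\nu_A(i)=i_t$. -}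

module Defs where

open import Data.Nat using (ℕ; zero; suc; _+_; _*_; _∸_; _<_; _≤_)
open import Data.Nat.Properties using (_≟_)
open import Data.Bool using (Bool; true; false)
open import Data.Maybe using (Maybe; just; nothing)
open import Data.Fin as Fin using (Fin)
open import Data.List using (List; []; _∷_; take; concatMap)
open import Data.List.Base using (allFin)
open import Data.Vec using (Vec; []; _∷_; lookup)
open import Data.Product using (_×_; _,_)
open import Data.Sum using (_⊎_)
open import Data.Unit using (⊤)
open import Relation.Nullary using (¬_; yes; no)
open import Relation.Binary.PropositionalEquality using (_≡_)

-- Permutations of {1,2,...} (elements of S_m act on {1..m} and fix the
-- rest), composition, simple reflections

Perm : Set
Perm = ℕ → ℕ

s : ℕ → Perm
s k a with a ≟ k | a ≟ suc k
... | yes _ | _     = suc k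
... | no _  | yes _ = k
... | no _  | no _  = a

prodWord : List ℕ → Perm
prodWord []       a = a
prodWord (k ∷ ks) a = s k (prodWord ks a)

-- Roots e_a - e_b, the action y(e_a - e_b) = e_{y(a)} - e_{y(b)}

record Root : Set where
  constructor root
  field
    a : ℕ
    b : ℕ

α : ℕ → Root
α k = root k (suc k)

act : Perm → Root → Root
act y (root a b) = root (y a) (y b)

Positive : Root → Set
Positive (root a b) = a < b

Negative : Root → Set
Negative (root a b) = b < a

-- a mask entry for one block: (x_{i,1}, x_{i,2}, x_{i,3}, x_{i,4}); true = 1
Mask : ℕ → Set
Mask l = Fin l → Vec Bool 4

block : ℕ → Vec ℕ 4
block j = 2 * j ∷ 2 * j ∸ 1 ∷ 2 * j + 1 ∷ 2 * j ∷ []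

zipBlock : ∀ {m} → Vec ℕ m → Vec Bool m → List (ℕ × Bool)
zipBlock []       []       = []
zipBlock (k ∷ ks) (b ∷ bs) = (k , b) ∷ zipBlock ks bs

maskedWord : ∀ {l} → (Fin l → ℕ) → Mask l → List (ℕ × Bool)
maskedWord {l} j x = concatMap (λ i → zipBlock (block (j i)) (x i)) (allFin l)

selected : List (ℕ × Bool) → List ℕ
selected []                = []
selected ((k , true)  ∷ w) = k ∷ selected w
selected ((k , false) ∷ w) = selected w

π : ∀ {l} → (Fin l → ℕ) → Mask l → ℕ → Perm
π j x p = prodWord (selected (take p (maskedWord j x)))

-- Patterns with * (nothing = arbitrary entry)

b0 b1 ⋆ : Maybe Bool
b0 = just false
b1 = just true
⋆  = nothing

_matches_ : ∀ {m} → Vec Bool m → Vec (Maybe Bool) m → Set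
[]      matches []             = ⊤
(b ∷ v) matches (nothing ∷ p)  = v matches p
(b ∷ v) matches (just c ∷ p)   = (b ≡ c) × (v matches p)

InIf : ∀ {l} → Mask l → Fin l → Set
InIf x i = x i matches (b1 ∷ b1 ∷ b1 ∷ b1 ∷ [])

-- Neighbour sets.  RightChain j A i r : i ∈ →N_A with ν_A(i) = r;
-- LeftChain j A i r : i ∈ ←N_A with ν_A(i) = r.
-- The chain i = i₀, i₁, …, i_t is given by seq 0, …, seq t.

record RightChain {l : ℕ} (j : Fin l → ℕ) (A : Fin l → Set) (i r : Fin l) : Set where
  field
    notIn   : ¬ A i
    t       : ℕ
    t>0     : 0 < t
    seq     : ℕ → Fin l
    start   : seq 0 ≡ i
    mono    : ∀ k → k < t → seq k Fin.< seq (suc k)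
    inA     : ∀ k → 1 ≤ k → k < t → A (seq k)
    lastOut : ¬ A (seq t)
    jval    : ∀ k → 1 ≤ k → k ≤ t → j (seq k) ≡ j i + k
    end     : seq t ≡ r

record LeftChain {l : ℕ} (j : Fin l → ℕ) (A : Fin l → Set) (i r : Fin l) : Set where
  field
    notIn   : ¬ A i
    t       : ℕ
    t>0     : 0 < t
    seq     : ℕ → Fin l
    start   : seq 0 ≡ i
    mono    : ∀ k → k < t → seq (suc k) Fin.< seq k
    inA     : ∀ k → 1 ≤ k → k < t → A (seq k)
    lastOut : ¬ A (seq t)
    jval    : ∀ k → 1 ≤ k → k ≤ t → j (seq k) ≡ j i + k
    end     : seq t ≡ r

C : ∀ {l} → (Fin l → ℕ) → Mask l → Fin l → Set
C {l} j x i = Data.Product.∃ λ (r : Fin l) → LeftChain j (InIf x) i r ×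
  (x r matches (b1 ∷ b1 ∷ b0 ∷ b1 ∷ []) ⊎ x r matches (⋆ ∷ b1 ∷ ⋆ ∷ b0 ∷ []))

Cback : ∀ {l} → (Fin l → ℕ) → Mask l → Fin l → Set
Cback {l} j x i = Data.Product.∃ λ (r : Fin l) → RightChain j (InIf x) r i ×
  (x r matches (b1 ∷ b0 ∷ b1 ∷ b1 ∷ []) ⊎ x r matches (⋆ ∷ ⋆ ∷ b1 ∷ b0 ∷ []))

ExactlyOne : Set → Set → Set → Set
ExactlyOne P Q R = (P × ¬ Q × ¬ R) ⊎ (¬ P × Q × ¬ R) ⊎ (¬ P × ¬ Q × R)

-- Let Y p = π_{4p} be the product of the first p blocks.  Block J is the translate by 2J - 1
-- of the local block s₁ s₀ s₂ s₁, so it moves only the points of its window [2J - 1, 2J + 2].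
-- As the j_i are distinct, Y (toℕ i) preserves the cut at 2 j_i inside the window of block i,
-- and fixes either half of that window unless the neighbouring block j_i ∓ 1 came earlier.
-- A case analysis on the mask of block i (InsideBlock) then gives (1) and reduces (2)-(4) to
-- two facts about the earlier blocks: the lower pair of the window is inverted iff ←C(x, i)
-- and the upper pair iff C(x, i).  These follow by induction over prefixes: a pair
-- (2q + 1, 2q + 2) is decided by the last block touching it, which either carries a pattern
-- of ←C or C (checked on all sixteen masks) or is full and hands the question to the
-- neighbouring pair.  The recursive predicate Reach so obtained is finally identified with
-- the chains of ←N and →N.

module Submission where

open import Defs
open import Data.Nat
open import Data.Nat.Properties
open import Data.Bool using (Bool; true; false)
import Data.Bool.Properties as Bool
open import Data.Maybe using (Maybe; just; nothing)
import Data.Vec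
open import Data.Vec using (Vec; []; _∷_; lookup)
open import Data.List using (List; []; _∷_; _++_; map; take; length; concat; tabulate)
open import Data.List.Properties using (take-map; map-tabulate; ++-assoc)
open import Data.List.Relation.Unary.All using (All; []; _∷_)
import Data.List.Relation.Unary.All.Properties as All
open import Data.Fin as Fin using (Fin; toℕ; fromℕ<)
open import Data.Fin.Properties using (toℕ-fromℕ<; toℕ-injective; toℕ<n)
open import Data.Product using (_×_; _,_; proj₁; proj₂; map₁; uncurry; Σ; ∃)
open import Data.Product.Function.NonDependent.Propositional using (_×-⇔_)
open import Data.Sum using (_⊎_; inj₁; inj₂; [_,_]′)
open import Data.Sum.Function.Propositional using (_⊎-⇔_)
open import Data.Unit using (tt)
open import Data.Empty using (⊥-elim)
open import Level using (0ℓ)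
open import Function using (_∘_; id)
open import Function.Bundles using (_⇔_; mk⇔)
open import Function.Definitions using (Injective)
import Function.Properties.Equivalence as ⇔
open import Relation.Nullary using (Dec; yes; no; ¬_)
open import Relation.Nullary.Decidable using (from-yes; map′; ¬?; _×-dec_; _⊎-dec_; _→-dec_)
open import Relation.Binary.PropositionalEquality
import Relation.Binary.Reasoning.Setoid as SetoidReasoning

s-fix : ∀ k a → a ≢ k → a ≢ suc k → s k a ≡ a
s-fix k a a≢k a≢k+1 with a ≟ k | a ≟ suc k
... | yes a≡k | _         = ⊥-elim (a≢k a≡k)
... | no _    | yes a≡k+1 = ⊥-elim (a≢k+1 a≡k+1)
... | no _    | no _      = refl

s-swap₁ : ∀ k → s k k ≡ suc k
s-swap₁ k with k ≟ k
... | yes _  = refl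
... | no k≢k = ⊥-elim (k≢k refl)

s-swap₂ : ∀ k → s k (suc k) ≡ k
s-swap₂ k with suc k ≟ k | suc k ≟ suc k
... | yes k+1≡k | _   = ⊥-elim (<⇒≢ (n<1+n k) (sym k+1≡k))
... | no _      | yes _ = refl
... | no _      | no ≢  = ⊥-elim (≢ refl)

s-shift : ∀ c k a → s (c + k) (c + a) ≡ c + s k a
s-shift c k a = by-cases (a ≟ k) (a ≟ suc k)
  where
  open ≡-Reasoning
  by-cases : Dec (a ≡ k) → Dec (a ≡ suc k) → s (c + k) (c + a) ≡ c + s k a
  by-cases (yes refl) _ = begin
    s (c + k) (c + k)        ≡⟨ s-swap₁ (c + k) ⟩
    suc (c + k)              ≡⟨ +-suc c k ⟨
    c + suc k                ≡⟨ cong (c +_) (s-swap₁ k) ⟨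
    c + s k k                ∎
  by-cases (no _) (yes refl) = begin
    s (c + k) (c + suc k)    ≡⟨ cong (s (c + k)) (+-suc c k) ⟩
    s (c + k) (suc (c + k))  ≡⟨ s-swap₂ (c + k) ⟩
    c + k                    ≡⟨ cong (c +_) (s-swap₂ k) ⟨
    c + s k (suc k)          ∎
  by-cases (no a≢k) (no a≢k+1) = begin
    s (c + k) (c + a)        ≡⟨ s-fix (c + k) (c + a) (λ e → a≢k (+-cancelˡ-≡ c a k e))
                                  (λ e → a≢k+1 (+-cancelˡ-≡ c a (suc k) (trans e (sym (+-suc c k))))) ⟩
    c + a                    ≡⟨ cong (c +_) (s-fix k a a≢k a≢k+1) ⟨
    c + s k a                ∎

s-above : ∀ {m} k a → k < m → m < a → s k a ≡ a
s-above {m} k a k<m m<a =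
  s-fix k a (λ a≡k → <-asym k<m (subst (m <_) a≡k m<a))
            (λ a≡k+1 → <-irrefl refl (≤-trans (subst (m <_) a≡k+1 m<a) k<m))

s-keeps : ∀ {m} k a → k < m → a ≤ m → s k a ≤ m
s-keeps {m} k a k<m a≤m = by-cases (a ≟ k) (a ≟ suc k)
  where
  by-cases : Dec (a ≡ k) → Dec (a ≡ suc k) → s k a ≤ m
  by-cases (yes refl) _          = subst (_≤ m) (sym (s-swap₁ k)) k<m
  by-cases (no _) (yes refl)     = subst (_≤ m) (sym (s-swap₂ k)) (<⇒≤ k<m)
  by-cases (no a≢k) (no a≢k+1)   = subst (_≤ m) (sym (s-fix k a a≢k a≢k+1)) a≤m

prodWord-++ : ∀ xs ys a → prodWord (xs ++ ys) a ≡ prodWord xs (prodWord ys a)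
prodWord-++ []       ys a = refl
prodWord-++ (k ∷ xs) ys a = cong (s k) (prodWord-++ xs ys a)

prodWord-shift : ∀ c ks a → prodWord (map (c +_) ks) (c + a) ≡ c + prodWord ks a
prodWord-shift c []       a = refl
prodWord-shift c (k ∷ ks) a = trans (cong (s (c + k)) (prodWord-shift c ks a)) (s-shift c k _)

prodWord-below : ∀ c ks a → a < c → prodWord (map (c +_) ks) a ≡ a
prodWord-below c []       a a<c = refl
prodWord-below c (k ∷ ks) a a<c = trans (cong (s (c + k)) (prodWord-below c ks a a<c))
  (s-fix (c + k) a (λ e → <⇒≢ (≤-trans a<c (m≤m+n c k)) e)
                   (λ e → <⇒≢ (≤-trans a<c (≤-trans (m≤m+n c k) (n≤1+n _))) e))

prodWord-above : ∀ {m} ks a → All (_< m) ks → m < a → prodWord ks a ≡ a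
prodWord-above []       a []         m<a = refl
prodWord-above (k ∷ ks) a (k<m ∷ ks<m) m<a =
  trans (cong (s k) (prodWord-above ks a ks<m m<a)) (s-above k a k<m m<a)

prodWord-keeps : ∀ {m} ks a → All (_< m) ks → a ≤ m → prodWord ks a ≤ m
prodWord-keeps []       a []           a≤m = a≤m
prodWord-keeps (k ∷ ks) a (k<m ∷ ks<m) a≤m = s-keeps k _ k<m (prodWord-keeps ks a ks<m a≤m)

-- The block s_{2J} s_{2J-1} s_{2J+1} s_{2J} of the doubled word, J = b + 1, is the
-- translate by  lo b = 2J - 1  of the local block s₁ s₀ s₂ s₁, whose window is [0, 3].
lo : ℕ → ℕ
lo b = suc (2 * b)

localBlock : Vec ℕ 4
localBlock = 1 ∷ 0 ∷ 2 ∷ 1 ∷ []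

blockProd : ℕ → ℕ → Vec Bool 4 → Perm
blockProd k J v = prodWord (selected (take k (zipBlock (block J) v)))

localWord : ℕ → Vec Bool 4 → List ℕ
localWord k v = selected (take k (zipBlock localBlock v))

localProd : ℕ → Vec Bool 4 → Perm
localProd k v = prodWord (localWord k v)

lo-1 : ∀ b → 2 * suc b ≡ lo b + 1
lo-1 b = trans (*-suc 2 b) (cong suc (+-comm 1 (2 * b)))

lo-0 : ∀ b → 2 * suc b ∸ 1 ≡ lo b + 0
lo-0 b = trans (cong (_∸ 1) (*-suc 2 b)) (sym (+-identityʳ _))

lo-2 : ∀ b → 2 * suc b + 1 ≡ lo b + 2
lo-2 b = trans (cong (_+ 1) (lo-1 b)) (+-assoc (lo b) 1 1)

lo-step : ∀ b e → lo (suc b) + e ≡ lo b + (2 + e)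
lo-step b e = trans (cong (_+ e) (trans (cong suc (lo-1 b)) (sym (+-suc (lo b) 1)))) (+-assoc (lo b) 2 e)

lo-top : ∀ b → lo b + 3 ≡ 2 * suc (suc b)
lo-top b = sym (trans (lo-1 (suc b)) (trans (cong suc (lo-2 b)) (sym (+-suc (lo b) 2))))

block-suc : ∀ b → block (suc b) ≡ Data.Vec.map (lo b +_) localBlock
block-suc b = letters (lo-1 b) (lo-0 b) (lo-2 b)
  where
  letters : ∀ {p q r p′ q′ r′ : ℕ} → p ≡ p′ → q ≡ q′ → r ≡ r′ →
            _≡_ {A = Vec ℕ 4} (p ∷ q ∷ r ∷ p ∷ []) (p′ ∷ q′ ∷ r′ ∷ p′ ∷ [])
  letters refl refl refl = refl

zipBlock-map : ∀ {m} (f : ℕ → ℕ) (ks : Vec ℕ m) (v : Vec Bool m) →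
               zipBlock (Data.Vec.map f ks) v ≡ map (map₁ f) (zipBlock ks v)
zipBlock-map f []       []       = refl
zipBlock-map f (k ∷ ks) (b ∷ bs) = cong ((f k , b) ∷_) (zipBlock-map f ks bs)

selected-map : ∀ (f : ℕ → ℕ) w → selected (map (map₁ f) w) ≡ map f (selected w)
selected-map f []                = refl
selected-map f ((k , true)  ∷ w) = cong (f k ∷_) (selected-map f w)
selected-map f ((k , false) ∷ w) = selected-map f w

blockLetters : ∀ k b v → selected (take k (zipBlock (block (suc b)) v))
                         ≡ map (lo b +_) (localWord k v)
blockLetters k b v = begin
  selected (take k (zipBlock (block (suc b)) v))
    ≡⟨ cong (λ ks → selected (take k (zipBlock ks v))) (block-suc b) ⟩
  selected (take k (zipBlock (Data.Vec.map (lo b +_) localBlock) v))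
    ≡⟨ cong (λ w → selected (take k w)) (zipBlock-map (lo b +_) localBlock v) ⟩
  selected (take k (map (map₁ (lo b +_)) (zipBlock localBlock v)))
    ≡⟨ cong selected (take-map k (zipBlock localBlock v)) ⟩
  selected (map (map₁ (lo b +_)) (take k (zipBlock localBlock v)))
    ≡⟨ selected-map (lo b +_) (take k (zipBlock localBlock v)) ⟩
  map (lo b +_) (localWord k v)  ∎
  where open ≡-Reasoning

blockProd-shift : ∀ k b v δ → blockProd k (suc b) v (lo b + δ) ≡ lo b + localProd k v δ
blockProd-shift k b v δ = trans (cong (λ ks → prodWord ks (lo b + δ)) (blockLetters k b v))
                                (prodWord-shift (lo b) (localWord k v) δ)

blockProd-below : ∀ k b v a → a < lo b → blockProd k (suc b) v a ≡ a
blockProd-below k b v a a<lo = trans (cong (λ ks → prodWord ks a) (blockLetters k b v))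
                                     (prodWord-below (lo b) (localWord k v) a a<lo)

localLetters : ∀ k v → All (_< 3) (localWord k v)
localLetters k (a ∷ b ∷ c ∷ d ∷ []) =
  selected-All (take k (zipBlock localBlock (a ∷ b ∷ c ∷ d ∷ [])))
               (All.take⁺ k (s≤s (s≤s z≤n) ∷ s≤s z≤n ∷ ≤-refl ∷ s≤s (s≤s z≤n) ∷ []))
  where
  selected-All : ∀ {P : ℕ → Set} w → All (P ∘ proj₁) w → All P (selected w)
  selected-All []                _          = []
  selected-All ((k , true)  ∷ w) (pk ∷ pw)  = pk ∷ selected-All w pw
  selected-All ((k , false) ∷ w) (_ ∷ pw)   = selected-All w pw

localProd-above : ∀ k v δ → 3 < δ → localProd k v δ ≡ δ
localProd-above k v δ = prodWord-above (localWord k v) δ (localLetters k v)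

localProd-keeps : ∀ k v δ → δ ≤ 3 → localProd k v δ ≤ 3
localProd-keeps k v δ = prodWord-keeps (localWord k v) δ (localLetters k v)

Cut : Perm → ℕ → Set
Cut Y t = ∀ a → (a ≤ t → Y a ≤ t) × (t < a → t < Y a)

cut-∘ : ∀ {Y Z t} → Cut Y t → Cut Z t → Cut (λ a → Y (Z a)) t
cut-∘ {Y} {Z} cutY cutZ a = (λ a≤t → proj₁ (cutY (Z a)) (proj₁ (cutZ a) a≤t))
                          , (λ t<a → proj₂ (cutY (Z a)) (proj₂ (cutZ a) t<a))

record WindowMap (c : ℕ) (G : Perm) : Set where
  field
    fixes : ∀ a → a < c ⊎ c + 3 < a → G a ≡ a
    keeps : ∀ a → c ≤ a → a ≤ c + 3 → c ≤ G a × G a ≤ c + 3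

window-cut : ∀ {c G} → WindowMap c G → ∀ t → t < c ⊎ c + 3 ≤ t → Cut G t
window-cut {c} {G} W t t-out a = by-position (a <? c) (c + 3 <? a)
  where
  Goal : Set
  Goal = (a ≤ t → G a ≤ t) × (t < a → t < G a)
  unmoved : G a ≡ a → Goal
  unmoved e = subst (_≤ t) (sym e) , subst (t <_) (sym e)
  inside : c ≤ a → a ≤ c + 3 → Goal
  inside c≤a a≤c+3 with WindowMap.keeps W a c≤a a≤c+3
  ... | c≤Ga , Ga≤c+3 = [ below-window , above-window ]′ t-out
    where
    below-window : t < c → Goal
    below-window t<c = (λ a≤t → ⊥-elim (<⇒≱ t<c (≤-trans c≤a a≤t))) , (λ _ → <-≤-trans t<c c≤Ga)
    above-window : c + 3 ≤ t → Goal
    above-window c+3≤t = (λ _ → ≤-trans Ga≤c+3 c+3≤t) , (λ t<a → ⊥-elim (<⇒≱ t<a (≤-trans a≤c+3 c+3≤t)))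
  by-position : Dec (a < c) → Dec (c + 3 < a) → Goal
  by-position (yes a<c) _           = unmoved (WindowMap.fixes W a (inj₁ a<c))
  by-position (no _)    (yes c+3<a) = unmoved (WindowMap.fixes W a (inj₂ c+3<a))
  by-position (no a≮c)  (no a≯c+3)  = inside (≮⇒≥ a≮c) (≮⇒≥ a≯c+3)

blockWindow : ∀ k b v → WindowMap (lo b) (blockProd k (suc b) v)
blockWindow k b v = record { fixes = fixes ; keeps = keeps }
  where
  c : ℕ
  c = lo b
  split : ∀ a → c ≤ a → a ≡ c + (a ∸ c)
  split a c≤a = sym (m+[n∸m]≡n c≤a)
  fixes : ∀ a → a < c ⊎ c + 3 < a → blockProd k (suc b) v a ≡ a
  fixes a (inj₁ a<c)   = blockProd-below k b v a a<c
  fixes a (inj₂ c+3<a) = begin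
    blockProd k (suc b) v a              ≡⟨ cong (blockProd k (suc b) v) a≡ ⟩
    blockProd k (suc b) v (c + (a ∸ c))  ≡⟨ blockProd-shift k b v (a ∸ c) ⟩
    c + localProd k v (a ∸ c)            ≡⟨ cong (c +_) (localProd-above k v (a ∸ c) 3<δ) ⟩
    c + (a ∸ c)                          ≡⟨ a≡ ⟨
    a                                    ∎
    where
    open ≡-Reasoning
    c≤a : c ≤ a
    c≤a = ≤-trans (m≤m+n c 3) (<⇒≤ c+3<a)
    a≡ : a ≡ c + (a ∸ c)
    a≡ = split a c≤a
    3<δ : 3 < a ∸ c
    3<δ = +-cancelˡ-< c 3 (a ∸ c) (subst (c + 3 <_) a≡ c+3<a)
  keeps : ∀ a → c ≤ a → a ≤ c + 3 → c ≤ blockProd k (suc b) v a × blockProd k (suc b) v a ≤ c + 3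
  keeps a c≤a a≤c+3 = subst (λ y → c ≤ y × y ≤ c + 3) (sym image)
                        (m≤m+n c _ , +-monoʳ-≤ c (localProd-keeps k v (a ∸ c) δ≤3))
    where
    image : blockProd k (suc b) v a ≡ c + localProd k v (a ∸ c)
    image = trans (cong (blockProd k (suc b) v) (split a c≤a)) (blockProd-shift k b v (a ∸ c))
    δ≤3 : a ∸ c ≤ 3
    δ≤3 = +-cancelˡ-≤ c (a ∸ c) 3 (subst (_≤ c + 3) (split a c≤a) a≤c+3)

take-++-short : ∀ {A : Set} (xs ys : List A) k → k ≤ length xs → take k (xs ++ ys) ≡ take k xs
take-++-short xs       ys zero    _         = refl
take-++-short (x ∷ xs) ys (suc k) (s≤s k≤n) = cong (x ∷_) (take-++-short xs ys k k≤n)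

take-++-long : ∀ {A : Set} {m} (xs ys : List A) n → length xs ≡ m → take (m + n) (xs ++ ys) ≡ xs ++ take n ys
take-++-long []       ys n refl = refl
take-++-long (x ∷ xs) ys n refl = cong (x ∷_) (take-++-long xs ys n refl)

take-concat : ∀ {A : Set} {m n} (f : Fin n → List A) → (∀ i → length (f i) ≡ m) →
              ∀ i k → k ≤ m →
              take (toℕ i * m + k) (concat (tabulate f)) ≡ take (toℕ i * m) (concat (tabulate f)) ++ take k (f i)
take-concat {m = m} f len Fin.zero k k≤m = take-++-short (f Fin.zero) _ k (subst (k ≤_) (sym (len Fin.zero)) k≤m)
take-concat {m = m} f len (Fin.suc i) k k≤m = begin
  take (m + toℕ i * m + k) (f Fin.zero ++ rest)       ≡⟨ cong (λ p → take p (f Fin.zero ++ rest)) (+-assoc m _ k) ⟩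
  take (m + (toℕ i * m + k)) (f Fin.zero ++ rest)     ≡⟨ take-++-long (f Fin.zero) rest _ (len Fin.zero) ⟩
  f Fin.zero ++ take (toℕ i * m + k) rest             ≡⟨ cong (f Fin.zero ++_) (take-concat (f ∘ Fin.suc) (len ∘ Fin.suc) i k k≤m) ⟩
  f Fin.zero ++ (take (toℕ i * m) rest ++ take k (f (Fin.suc i)))  ≡⟨ ++-assoc (f Fin.zero) _ _ ⟨
  (f Fin.zero ++ take (toℕ i * m) rest) ++ take k (f (Fin.suc i))  ≡⟨ cong (_++ take k (f (Fin.suc i))) (take-++-long (f Fin.zero) rest _ (len Fin.zero)) ⟨
  take (m + toℕ i * m) (f Fin.zero ++ rest) ++ take k (f (Fin.suc i))  ∎
  where
  open ≡-Reasoning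
  rest : List _
  rest = concat (tabulate (f ∘ Fin.suc))

selected-++ : ∀ xs ys → selected (xs ++ ys) ≡ selected xs ++ selected ys
selected-++ []                 ys = refl
selected-++ ((k , true)  ∷ xs) ys = cong (k ∷_) (selected-++ xs ys)
selected-++ ((k , false) ∷ xs) ys = selected-++ xs ys

π-split : ∀ {l} (j : Fin l → ℕ) (x : Mask l) (i : Fin l) k → k ≤ 4 → ∀ a →
          π j x (4 * toℕ i + k) a ≡ π j x (4 * toℕ i) (blockProd k (j i) (x i) a)
π-split j x i k k≤4 a = begin
  π j x (4 * toℕ i + k) a
    ≡⟨ cong (λ w → prodWord (selected (take (p + k) w)) a) word ⟩
  prodWord (selected (take (p + k) blocks)) a
    ≡⟨ cong (λ q → prodWord (selected (take (q + k) blocks)) a) (*-comm 4 (toℕ i)) ⟩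
  prodWord (selected (take (toℕ i * 4 + k) blocks)) a
    ≡⟨ cong (λ w → prodWord (selected w) a) (take-concat masked (λ i′ → blockLength (j i′) (x i′)) i k k≤4) ⟩
  prodWord (selected (take (toℕ i * 4) blocks ++ take k (masked i))) a
    ≡⟨ cong (λ w → prodWord w a) (selected-++ (take (toℕ i * 4) blocks) _) ⟩
  prodWord (selected (take (toℕ i * 4) blocks) ++ selected (take k (masked i))) a
    ≡⟨ prodWord-++ (selected (take (toℕ i * 4) blocks)) _ a ⟩
  prodWord (selected (take (toℕ i * 4) blocks)) (blockProd k (j i) (x i) a)
    ≡⟨ cong (λ q → prodWord (selected (take q blocks)) (blockProd k (j i) (x i) a)) (*-comm (toℕ i) 4) ⟩
  prodWord (selected (take p blocks)) (blockProd k (j i) (x i) a)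
    ≡⟨ cong (λ w → prodWord (selected (take p w)) (blockProd k (j i) (x i) a)) word ⟨
  π j x (4 * toℕ i) (blockProd k (j i) (x i) a)  ∎
  where
  open ≡-Reasoning
  p : ℕ
  p = 4 * toℕ i
  masked : Fin _ → List (ℕ × Bool)
  masked i′ = zipBlock (block (j i′)) (x i′)
  blocks : List (ℕ × Bool)
  blocks = concat (tabulate masked)
  word : maskedWord j x ≡ blocks
  word = cong concat (map-tabulate id masked)
  blockLength : ∀ J (v : Vec Bool 4) → length (zipBlock (block J) v) ≡ 4
  blockLength J (_ ∷ _ ∷ _ ∷ _ ∷ []) = refl

_matches?_ : ∀ {m} (v : Vec Bool m) p → Dec (v matches p)
[]      matches? []            = yes tt
(b ∷ v) matches? (nothing ∷ p) = v matches? p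
(b ∷ v) matches? (just c ∷ p)  = (b Bool.≟ c) ×-dec (v matches? p)

all-Bool? : {P : Bool → Set} → (∀ b → Dec (P b)) → Dec (∀ b → P b)
all-Bool? P? = map′ (λ (f , t) → λ { false → f ; true → t }) (λ h → h false , h true) (P? false ×-dec P? true)

all-masks? : {P : Vec Bool 4 → Set} → (∀ v → Dec (P v)) → Dec (∀ v → P v)
all-masks? P? = map′ (λ h → λ { (a ∷ b ∷ c ∷ d ∷ []) → h a b c d }) (λ h a b c d → h (a ∷ b ∷ c ∷ d ∷ []))
  (all-Bool? λ a → all-Bool? λ b → all-Bool? λ c → all-Bool? λ d → P? (a ∷ b ∷ c ∷ d ∷ []))

R : Vec Bool 4 → ℕ → ℕ
R = localProd 4

Pattern : Set
Pattern = Vec (Maybe Bool) 4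

full upper₁ upper₂ lower₁ lower₂ : Pattern
full   = b1 ∷ b1 ∷ b1 ∷ b1 ∷ []
upper₁ = b1 ∷ b0 ∷ b1 ∷ b1 ∷ []
upper₂ = ⋆ ∷ ⋆ ∷ b1 ∷ b0 ∷ []
lower₁ = b1 ∷ b1 ∷ b0 ∷ b1 ∷ []
lower₂ = ⋆ ∷ b1 ∷ ⋆ ∷ b0 ∷ []

-- Full v is the membership x_i ∈ I_f; the two other patterns are the masks of ←C and C.
Full UpperPattern LowerPattern : Vec Bool 4 → Set
Full v = v matches full
UpperPattern v = v matches upper₁ ⊎ v matches upper₂
LowerPattern v = v matches lower₁ ⊎ v matches lower₂

full-swaps : ∀ v → Full v → (R v 0 ≡ 2) × (R v 1 ≡ 3) × (R v 2 ≡ 0) × (R v 3 ≡ 1)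
full-swaps (true ∷ true ∷ true ∷ true ∷ []) _ = refl , refl , refl , refl

UpperLaw LowerLaw : Vec Bool 4 → Set
UpperLaw v = ¬ Full v → (2 ≤ R v 2 ⊎ 2 ≤ R v 3) × (R v 3 < R v 2 → UpperPattern v) × (UpperPattern v → R v 3 < R v 2)
LowerLaw v = ¬ Full v → (R v 0 ≤ 1 ⊎ R v 1 ≤ 1) × (R v 1 < R v 0 → LowerPattern v) × (LowerPattern v → R v 1 < R v 0)

upperLaw : ∀ v → UpperLaw v
upperLaw = from-yes (all-masks? {UpperLaw} λ v →
  ¬? (v matches? full) →-dec ((2 ≤? R v 2 ⊎-dec 2 ≤? R v 3)
    ×-dec (R v 3 <? R v 2 →-dec upper? v) ×-dec (upper? v →-dec R v 3 <? R v 2)))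
  where
  upper? : ∀ v → Dec (UpperPattern v)
  upper? v = (v matches? upper₁) ⊎-dec (v matches? upper₂)

lowerLaw : ∀ v → LowerLaw v
lowerLaw = from-yes (all-masks? {LowerLaw} λ v →
  ¬? (v matches? full) →-dec ((R v 0 ≤? 1 ⊎-dec R v 1 ≤? 1)
    ×-dec (R v 1 <? R v 0 →-dec lower? v) ×-dec (lower? v →-dec R v 1 <? R v 0)))
  where
  lower? : ∀ v → Dec (LowerPattern v)
  lower? v = (v matches? lower₁) ⊎-dec (v matches? lower₂)

full-not-upper : ∀ v → Full v → ¬ UpperPattern v
full-not-upper (true ∷ true ∷ true ∷ true ∷ []) _ (inj₁ (_ , () , _))
full-not-upper (true ∷ true ∷ true ∷ true ∷ []) _ (inj₂ (_ , () , _))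

full-not-lower : ∀ v → Full v → ¬ LowerPattern v
full-not-lower (true ∷ true ∷ true ∷ true ∷ []) _ (inj₁ (_ , _ , () , _))
full-not-lower (true ∷ true ∷ true ∷ true ∷ []) _ (inj₂ (_ , () , _))

module ⇔-Reasoning = SetoidReasoning (⇔.⇔-setoid 0ℓ)

⊥⇔⊥ : ∀ {A B : Set} → ¬ A → ¬ B → A ⇔ B
⊥⇔⊥ ¬a ¬b = mk⇔ (⊥-elim ∘ ¬a) (⊥-elim ∘ ¬b)

drop-true : ∀ {A B : Set} → A → (A × B) ⇔ B
drop-true a = mk⇔ proj₂ (a ,_)

left-only : ∀ {A B : Set} → ¬ B → (A ⊎ B) ⇔ A
left-only ¬b = mk⇔ (λ { (inj₁ a) → a ; (inj₂ b) → ⊥-elim (¬b b) }) inj₁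

right-only : ∀ {A B : Set} → ¬ A → (A ⊎ B) ⇔ B
right-only ¬a = mk⇔ (λ { (inj₁ a) → ⊥-elim (¬a a) ; (inj₂ b) → b }) inj₂

cut-separates : ∀ {Y t a b} → Cut Y t → a ≤ t → t < b → Y a < Y b
cut-separates {Y} {t} {a} {b} cut a≤t t<b = ≤-<-trans (proj₁ (cut a) a≤t) (proj₂ (cut b) t<b)

fixed-order : ∀ {p q a b : ℕ} → p ≡ a → q ≡ b → (p < q ⇔ a < b)
fixed-order refl refl = mk⇔ id id

cut-order : ∀ {Y t} a b → Cut Y t →
            ((a ≤ t × b ≤ t) ⊎ (t < a × t < b) → Y a ≡ a × Y b ≡ b) →
            (Y a < Y b ⇔ a < b)
cut-order {Y} {t} a b cut fixed with a ≤? t | b ≤? t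
... | yes a≤t | yes b≤t = uncurry fixed-order (fixed (inj₁ (a≤t , b≤t)))
... | yes a≤t | no b≰t  = mk⇔ (λ _ → ≤-<-trans a≤t (≰⇒> b≰t)) (λ _ → cut-separates cut a≤t (≰⇒> b≰t))
... | no a≰t  | yes b≤t = ⊥⇔⊥ (<-asym (cut-separates cut b≤t (≰⇒> a≰t))) (<-asym (≤-<-trans b≤t (≰⇒> a≰t)))
... | no a≰t  | no b≰t  = uncurry fixed-order (fixed (inj₂ (≰⇒> a≰t , ≰⇒> b≰t)))

exactly-first : ∀ {P Q R : Set} → P → ¬ Q → ¬ R → ExactlyOne P Q R
exactly-first p ¬q ¬r = inj₁ (p , ¬q , ¬r)

exactly-second : ∀ {P Q R : Set} → ¬ P → ¬ R → (ExactlyOne P Q R ⇔ Q)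
exactly-second ¬p ¬r = mk⇔ (λ { (inj₁ (p , _)) → ⊥-elim (¬p p) ; (inj₂ (inj₁ (_ , q , _))) → q
                              ; (inj₂ (inj₂ (_ , _ , r))) → ⊥-elim (¬r r) })
                           (λ q → inj₂ (inj₁ (¬p , q , ¬r)))

exactly-third : ∀ {P Q R : Set} → ¬ P → ¬ Q → (ExactlyOne P Q R ⇔ R)
exactly-third ¬p ¬q = mk⇔ (λ { (inj₁ (p , _)) → ⊥-elim (¬p p) ; (inj₂ (inj₁ (_ , q , _))) → ⊥-elim (¬q q)
                             ; (inj₂ (inj₂ (_ , _ , r))) → r })
                          (λ r → inj₂ (inj₂ (¬p , ¬q , r)))

exactly-none : ∀ {P Q R : Set} → ¬ P → ¬ Q → ¬ R → ¬ ExactlyOne P Q R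
exactly-none ¬p ¬q ¬r (inj₁ (p , _))            = ¬p p
exactly-none ¬p ¬q ¬r (inj₂ (inj₁ (_ , q , _))) = ¬q q
exactly-none ¬p ¬q ¬r (inj₂ (inj₂ (_ , _ , r))) = ¬r r

-- Y is the product of the earlier blocks: it preserves the cut
-- at c + 1, and for non-full v it inverts the lower pair (c, c + 1) exactly when
-- ←C holds and the upper pair (c + 2, c + 3) exactly when C holds.
module InsideBlock (Y : Perm) (c : ℕ) (cut : Cut Y (c + 1)) where

  separated : ∀ d₁ d₂ → d₁ ≤ 1 → 2 ≤ d₂ → Y (c + d₁) < Y (c + d₂)
  separated d₁ d₂ d₁≤1 2≤d₂ = cut-separates cut (+-monoʳ-≤ c d₁≤1) (+-monoʳ-< c 2≤d₂)

  not-inverted : ∀ d₁ d₂ → d₁ ≤ 1 → 2 ≤ d₂ → ¬ (Y (c + d₂) < Y (c + d₁))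
  not-inverted d₁ d₂ d₁≤1 2≤d₂ = <-asym (separated d₁ d₂ d₁≤1 2≤d₂)

  LowerInversion UpperInversion : Vec Bool 4 → Set → Set
  LowerInversion v ←C = ¬ Full v → (Y (c + 1) < Y (c + 0) ⇔ ←C)
  UpperInversion v C  = ¬ Full v → (Y (c + 3) < Y (c + 2) ⇔ C)

  -- after the letter s_{2j}: the pair (c, c + 1), i.e. the root α_{2j-1}
  after₁ : ∀ v {←C} → LowerInversion v ←C →
           (Y (c + localProd 1 v 1) < Y (c + localProd 1 v 0) ⇔ (lookup v Fin.zero ≡ false × ←C))
  after₁ (true  ∷ _) lower = ⊥⇔⊥ (not-inverted 0 2 z≤n ≤-refl) (λ ())
  after₁ (false ∷ _) lower = ⇔.trans (lower λ ()) (⇔.sym (drop-true refl))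

  -- after the letters s_{2j} s_{2j-1}: the pair (c + 2, c + 3), i.e. the root α_{2j+1}
  after₂ : ∀ v {C} → UpperInversion v C →
           (Y (c + localProd 2 v 3) < Y (c + localProd 2 v 2) ⇔ (lookup v Fin.zero ≡ false × C))
  after₂ (true  ∷ true ∷ _)  upper = ⊥⇔⊥ (not-inverted 1 3 (s≤s z≤n) (s≤s (s≤s z≤n))) (λ ())
  after₂ (true  ∷ false ∷ _) upper = ⊥⇔⊥ (not-inverted 1 3 (s≤s z≤n) (s≤s (s≤s z≤n))) (λ ())
  after₂ (false ∷ true ∷ _)  upper = ⇔.trans (upper λ ()) (⇔.sym (drop-true refl))
  after₂ (false ∷ false ∷ _) upper = ⇔.trans (upper λ ()) (⇔.sym (drop-true refl))

  -- after the letters s_{2j} s_{2j-1} s_{2j+1}: the pair (c + 1, c + 2), i.e. the root α_{2j}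
  after₃ : ∀ v {←C C} → LowerInversion v ←C → UpperInversion v C →
           (Y (c + localProd 3 v 2) < Y (c + localProd 3 v 1) ⇔
              ExactlyOne (v matches (b1 ∷ b0 ∷ b0 ∷ ⋆ ∷ []))
                         (v matches (b1 ∷ b0 ∷ b1 ∷ ⋆ ∷ []) × C)
                         (v matches (b1 ∷ b1 ∷ b0 ∷ ⋆ ∷ []) × ←C))
  after₃ (false ∷ false ∷ false ∷ _ ∷ []) lower upper =
    ⊥⇔⊥ (not-inverted 1 2 (s≤s z≤n) ≤-refl) (exactly-none (λ ()) (λ ()) (λ ()))
  after₃ (false ∷ false ∷ true ∷ _ ∷ []) lower upper =
    ⊥⇔⊥ (not-inverted 1 3 (s≤s z≤n) (s≤s (s≤s z≤n))) (exactly-none (λ ()) (λ ()) (λ ()))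
  after₃ (false ∷ true ∷ false ∷ _ ∷ []) lower upper =
    ⊥⇔⊥ (not-inverted 0 2 z≤n ≤-refl) (exactly-none (λ ()) (λ ()) (λ ()))
  after₃ (false ∷ true ∷ true ∷ _ ∷ []) lower upper =
    ⊥⇔⊥ (not-inverted 0 3 z≤n (s≤s (s≤s z≤n))) (exactly-none (λ ()) (λ ()) (λ ()))
  after₃ (true ∷ false ∷ false ∷ _ ∷ []) lower upper =
    mk⇔ (λ _ → exactly-first (refl , refl , refl , tt) (λ ()) (λ ())) (λ _ → separated 1 2 (s≤s z≤n) ≤-refl)
  after₃ (true ∷ false ∷ true ∷ _ ∷ []) lower upper =
    ⇔.trans (upper λ ()) (⇔.sym (⇔.trans (exactly-second (λ ()) (λ ())) (drop-true (refl , refl , refl , tt))))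
  after₃ (true ∷ true ∷ false ∷ _ ∷ []) lower upper =
    ⇔.trans (lower λ ()) (⇔.sym (⇔.trans (exactly-third (λ ()) (λ ())) (drop-true (refl , refl , refl , tt))))
  after₃ (true ∷ true ∷ true ∷ _ ∷ []) lower upper =
    ⊥⇔⊥ (not-inverted 0 3 z≤n (s≤s (s≤s z≤n))) (exactly-none (λ ()) (λ ()) (λ ()))

prefix-induction : ∀ {l} (P : ℕ → Set) → P 0 → (∀ (i : Fin l) → P (toℕ i) → P (suc (toℕ i))) →
                   ∀ p → p ≤ l → P p
prefix-induction P P0 step zero    _   = P0
prefix-induction P P0 step (suc p) p<l = subst P (cong suc (toℕ-fromℕ< p<l))
  (step (fromℕ< p<l) (subst P (sym (toℕ-fromℕ< p<l)) (prefix-induction P P0 step p (<⇒≤ p<l))))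

module Prefixes {l : ℕ} (j : Fin l → ℕ) (x : Mask l) (j≥1 : ∀ i → 1 ≤ j i) (j-inj : Injective _≡_ _≡_ j) where

  Y : ℕ → Perm
  Y p = π j x (4 * p)

  Y-step : ∀ (i : Fin l) a → Y (suc (toℕ i)) a ≡ Y (toℕ i) (blockProd 4 (j i) (x i) a)
  Y-step i a = trans (cong (λ q → π j x q a) (trans (*-suc 4 (toℕ i)) (+-comm 4 (4 * toℕ i))))
                     (π-split j x i 4 ≤-refl a)

  b : Fin l → ℕ
  b i = pred (j i)

  j≡suc-b : ∀ i → j i ≡ suc (b i)
  j≡suc-b i with j i | j≥1 i
  ... | suc _ | _ = refl

  c : Fin l → ℕ
  c i = lo (b i)

  2j-1≡ : ∀ i → 2 * j i ∸ 1 ≡ c i + 0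
  2j-1≡ i = trans (cong (λ J → 2 * J ∸ 1) (j≡suc-b i)) (lo-0 (b i))

  2j≡ : ∀ i → 2 * j i ≡ c i + 1
  2j≡ i = trans (cong (2 *_) (j≡suc-b i)) (lo-1 (b i))

  2j+1≡ : ∀ i → 2 * j i + 1 ≡ c i + 2
  2j+1≡ i = trans (cong (λ J → 2 * J + 1) (j≡suc-b i)) (lo-2 (b i))

  lo-next : ∀ i e → lo (j i) + e ≡ c i + (2 + e)
  lo-next i e = trans (cong (λ J → lo J + e) (j≡suc-b i)) (lo-step (b i) e)

  blockWindowᵢ : ∀ k i → WindowMap (c i) (blockProd k (j i) (x i))
  blockWindowᵢ k i = subst (λ J → WindowMap (c i) (blockProd k J (x i))) (sym (j≡suc-b i)) (blockWindow k (b i) (x i))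

  blockLocalᵢ : ∀ k i δ → blockProd k (j i) (x i) (c i + δ) ≡ c i + localProd k (x i) δ
  blockLocalᵢ k i δ = subst (λ J → blockProd k J (x i) (c i + δ) ≡ c i + localProd k (x i) δ)
                            (sym (j≡suc-b i)) (blockProd-shift k (b i) (x i) δ)

  Avoid : ℕ → ℕ → Set
  Avoid p K = ∀ m → toℕ m < p → j m ≢ K

  avoid-earlier : ∀ (i : Fin l) {K} → Avoid (suc (toℕ i)) K → Avoid (toℕ i) K
  avoid-earlier i av m m<i = av m (≤-trans m<i (n≤1+n _))

  avoid-here : ∀ (i : Fin l) {K} → Avoid (suc (toℕ i)) K → j i ≢ K
  avoid-here i av = av i ≤-refl

  avoid-self : ∀ i → Avoid (toℕ i) (j i)
  avoid-self i m m<i jm≡ji = <-irrefl (cong toℕ (j-inj jm≡ji)) m<i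

  block-cut : ∀ i K → j i ≢ K → Cut (blockProd 4 (j i) (x i)) (2 * K)
  block-cut i K ji≢K = window-cut (blockWindowᵢ 4 i) (2 * K) (position (K ≤? b i))
    where
    position : Dec (K ≤ b i) → 2 * K < c i ⊎ c i + 3 ≤ 2 * K
    position (yes K≤b) = inj₁ (s≤s (*-monoʳ-≤ 2 K≤b))
    position (no K≰b)  = inj₂ (subst (_≤ 2 * K) (sym (lo-top (b i)))
      (*-monoʳ-≤ 2 (≤∧≢⇒< (≰⇒> K≰b) (λ e → ji≢K (trans (j≡suc-b i) e)))))

  block-fix : ∀ i q → j i ≢ q → j i ≢ suc q → ∀ e → e ≤ 1 → blockProd 4 (j i) (x i) (lo q + e) ≡ lo q + e
  block-fix i q ji≢q ji≢q+1 e e≤1 = WindowMap.fixes (blockWindowᵢ 4 i) (lo q + e) (position (q <? b i))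
    where
    position : Dec (q < b i) → lo q + e < c i ⊎ c i + 3 < lo q + e
    position (yes q<b) = inj₁ (≤-<-trans (+-monoʳ-≤ (lo q) e≤1) (subst (_< c i) (lo-1 q) (s≤s (*-monoʳ-≤ 2 q<b))))
    position (no q≮b)  = inj₂ (subst (_< lo q + e) (sym (lo-top (b i)))
      (≤-trans (s≤s (*-monoʳ-≤ 2 b+2≤q)) (m≤m+n (lo q) e)))
      where
      b<q : b i < q
      b<q = ≤∧≢⇒< (≮⇒≥ q≮b) (λ e → ji≢q+1 (trans (j≡suc-b i) (cong suc e)))
      b+2≤q : suc (suc (b i)) ≤ q
      b+2≤q = ≤∧≢⇒< b<q (λ e → ji≢q (trans (j≡suc-b i) e))

  prefix-cut : ∀ p → p ≤ l → ∀ K → Avoid p K → Cut (Y p) (2 * K)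
  prefix-cut = prefix-induction (λ p → ∀ K → Avoid p K → Cut (Y p) (2 * K)) (λ _ _ a → id , id) step
    where
    step : ∀ (i : Fin l) → (∀ K → Avoid (toℕ i) K → Cut (Y (toℕ i)) (2 * K)) →
           ∀ K → Avoid (suc (toℕ i)) K → Cut (Y (suc (toℕ i))) (2 * K)
    step i ih K av a rewrite Y-step i a = cut-∘ (ih K (avoid-earlier i av)) (block-cut i K (avoid-here i av)) a

  prefix-fix : ∀ p → p ≤ l → ∀ q → Avoid p q → Avoid p (suc q) → ∀ e → e ≤ 1 → Y p (lo q + e) ≡ lo q + e
  prefix-fix = prefix-induction (λ p → ∀ q → Avoid p q → Avoid p (suc q) → ∀ e → e ≤ 1 → Y p (lo q + e) ≡ lo q + e)
                                (λ _ _ _ _ _ → refl) step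
    where
    step : ∀ (i : Fin l) → (∀ q → Avoid (toℕ i) q → Avoid (toℕ i) (suc q) → ∀ e → e ≤ 1 → Y (toℕ i) (lo q + e) ≡ lo q + e) →
           ∀ q → Avoid (suc (toℕ i)) q → Avoid (suc (toℕ i)) (suc q) → ∀ e → e ≤ 1 → Y (suc (toℕ i)) (lo q + e) ≡ lo q + e
    step i ih q av₀ av₁ e e≤1 = begin
      Y (suc (toℕ i)) (lo q + e)                       ≡⟨ Y-step i _ ⟩
      Y (toℕ i) (blockProd 4 (j i) (x i) (lo q + e))   ≡⟨ cong (Y (toℕ i)) (block-fix i q (avoid-here i av₀) (avoid-here i av₁) e e≤1) ⟩
      Y (toℕ i) (lo q + e)                             ≡⟨ ih q (avoid-earlier i av₀) (avoid-earlier i av₁) e e≤1 ⟩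
      lo q + e                                         ∎
      where open ≡-Reasoning

  Inverted : ℕ → ℕ → Set
  Inverted p q = Y p (lo q + 1) < Y p (lo q + 0)

  cut-before : ∀ i → Cut (Y (toℕ i)) (c i + 1)
  cut-before i = subst (Cut (Y (toℕ i))) (2j≡ i)
                       (prefix-cut (toℕ i) (<⇒≤ (toℕ<n i)) (j i) (avoid-self i))

  fixed-lower : ∀ i d → d ≤ 1 → Avoid (toℕ i) (b i) → Y (toℕ i) (c i + d) ≡ c i + d
  fixed-lower i d d≤1 av = prefix-fix (toℕ i) (<⇒≤ (toℕ<n i)) (b i) av
                             (subst (Avoid (toℕ i)) (j≡suc-b i) (avoid-self i)) d d≤1

  fixed-upper : ∀ i d → 2 ≤ d → d ≤ 3 → Avoid (toℕ i) (suc (j i)) → Y (toℕ i) (c i + d) ≡ c i + d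
  fixed-upper i (suc (suc e)) (s≤s (s≤s z≤n)) (s≤s (s≤s e≤1)) av =
    subst (λ z → Y (toℕ i) z ≡ z) (lo-step (b i) e)
      (prefix-fix (toℕ i) (<⇒≤ (toℕ<n i)) (suc (b i))
        (subst (Avoid (toℕ i)) (j≡suc-b i) (avoid-self i)) (subst (λ J → Avoid (toℕ i) (suc J)) (j≡suc-b i) av) e e≤1)

  window-order : ∀ i d₁ d₂ → d₁ ≤ 3 → d₂ ≤ 3 →
                 (d₁ ≤ 1 → d₂ ≤ 1 → Avoid (toℕ i) (b i)) →
                 (2 ≤ d₁ → 2 ≤ d₂ → Avoid (toℕ i) (suc (j i))) →
                 (Y (toℕ i) (c i + d₁) < Y (toℕ i) (c i + d₂) ⇔ d₁ < d₂)
  window-order i d₁ d₂ d₁≤3 d₂≤3 lower upper =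
    ⇔.trans (cut-order (c i + d₁) (c i + d₂) (cut-before i) same-side)
            (mk⇔ (+-cancelˡ-< (c i) d₁ d₂) (+-monoʳ-< (c i)))
    where
    same-side : (c i + d₁ ≤ c i + 1 × c i + d₂ ≤ c i + 1) ⊎ (c i + 1 < c i + d₁ × c i + 1 < c i + d₂) →
                Y (toℕ i) (c i + d₁) ≡ c i + d₁ × Y (toℕ i) (c i + d₂) ≡ c i + d₂
    same-side (inj₁ (p₁ , p₂)) = let d₁≤1 = +-cancelˡ-≤ (c i) d₁ 1 p₁ ; d₂≤1 = +-cancelˡ-≤ (c i) d₂ 1 p₂ in
      fixed-lower i d₁ d₁≤1 (lower d₁≤1 d₂≤1) , fixed-lower i d₂ d₂≤1 (lower d₁≤1 d₂≤1)
    same-side (inj₂ (p₁ , p₂)) = let 2≤d₁ = +-cancelˡ-< (c i) 1 d₁ p₁ ; 2≤d₂ = +-cancelˡ-< (c i) 1 d₂ p₂ in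
      fixed-upper i d₁ 2≤d₁ d₁≤3 (upper 2≤d₁ 2≤d₂) , fixed-upper i d₂ 2≤d₂ d₂≤3 (upper 2≤d₁ 2≤d₂)

  Y-local : ∀ i δ → Y (suc (toℕ i)) (c i + δ) ≡ Y (toℕ i) (c i + R (x i) δ)
  Y-local i δ = trans (Y-step i _) (cong (Y (toℕ i)) (blockLocalᵢ 4 i δ))

  upper-after : ∀ i → Avoid (toℕ i) (suc (j i)) →
                (Y (suc (toℕ i)) (c i + 3) < Y (suc (toℕ i)) (c i + 2))
                  ⇔ ((Full (x i) × Inverted (toℕ i) (b i)) ⊎ UpperPattern (x i))
  upper-after i av = by-mask (x i matches? full)
    where
    open ⇔-Reasoning
    v : Vec Bool 4
    v = x i
    p : ℕ
    p = toℕ i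
    by-mask : Dec (Full v) → (Y (suc p) (c i + 3) < Y (suc p) (c i + 2)) ⇔ ((Full v × Inverted p (b i)) ⊎ UpperPattern v)
    by-mask (yes f) = begin
      Y (suc p) (c i + 3) < Y (suc p) (c i + 2)   ≡⟨ cong₂ _<_ (Y-local i 3) (Y-local i 2) ⟩
      Y p (c i + R v 3) < Y p (c i + R v 2)       ≡⟨ cong₂ (λ d₁ d₂ → Y p (c i + d₁) < Y p (c i + d₂)) R3≡1 R2≡0 ⟩
      Inverted p (b i)                            ≈⟨ drop-true f ⟨
      (Full v × Inverted p (b i))                 ≈⟨ left-only (full-not-upper v f) ⟨
      ((Full v × Inverted p (b i)) ⊎ UpperPattern v) ∎
      where
      R3≡1 : R v 3 ≡ 1
      R3≡1 = proj₂ (proj₂ (proj₂ (full-swaps v f)))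
      R2≡0 : R v 2 ≡ 0
      R2≡0 = proj₁ (proj₂ (proj₂ (full-swaps v f)))
    by-mask (no nf) = begin
      Y (suc p) (c i + 3) < Y (suc p) (c i + 2)   ≡⟨ cong₂ _<_ (Y-local i 3) (Y-local i 2) ⟩
      Y p (c i + R v 3) < Y p (c i + R v 2)       ≈⟨ window-order i (R v 3) (R v 2) (localProd-keeps 4 v 3 (s≤s (s≤s (s≤s z≤n))))
                                                       (localProd-keeps 4 v 2 (s≤s (s≤s z≤n))) both-low (λ _ _ → av) ⟩
      R v 3 < R v 2                               ≈⟨ mk⇔ (proj₁ (proj₂ law)) (proj₂ (proj₂ law)) ⟩
      UpperPattern v                              ≈⟨ right-only (nf ∘ proj₁) ⟨
      ((Full v × Inverted p (b i)) ⊎ UpperPattern v) ∎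
      where
      law : (2 ≤ R v 2 ⊎ 2 ≤ R v 3) × (R v 3 < R v 2 → UpperPattern v) × (UpperPattern v → R v 3 < R v 2)
      law = upperLaw v nf
      both-low : R v 3 ≤ 1 → R v 2 ≤ 1 → Avoid p (b i)
      both-low R3≤1 R2≤1 = ⊥-elim ([ (λ 2≤R2 → <⇒≱ 2≤R2 R2≤1) , (λ 2≤R3 → <⇒≱ 2≤R3 R3≤1) ]′ (proj₁ law))

  lower-after : ∀ i → Avoid (toℕ i) (b i) →
                (Y (suc (toℕ i)) (c i + 1) < Y (suc (toℕ i)) (c i + 0))
                  ⇔ ((Full (x i) × Inverted (toℕ i) (j i)) ⊎ LowerPattern (x i))
  lower-after i av = by-mask (x i matches? full)
    where
    open ⇔-Reasoning
    v : Vec Bool 4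
    v = x i
    p : ℕ
    p = toℕ i
    by-mask : Dec (Full v) → (Y (suc p) (c i + 1) < Y (suc p) (c i + 0)) ⇔ ((Full v × Inverted p (j i)) ⊎ LowerPattern v)
    by-mask (yes f) = begin
      Y (suc p) (c i + 1) < Y (suc p) (c i + 0)   ≡⟨ cong₂ _<_ (Y-local i 1) (Y-local i 0) ⟩
      Y p (c i + R v 1) < Y p (c i + R v 0)       ≡⟨ cong₂ (λ d₁ d₂ → Y p (c i + d₁) < Y p (c i + d₂)) R1≡3 R0≡2 ⟩
      Y p (c i + 3) < Y p (c i + 2)               ≡⟨ cong₂ (λ a₁ a₂ → Y p a₁ < Y p a₂) (lo-next i 1) (lo-next i 0) ⟨
      Inverted p (j i)                            ≈⟨ drop-true f ⟨
      (Full v × Inverted p (j i))                 ≈⟨ left-only (full-not-lower v f) ⟨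
      ((Full v × Inverted p (j i)) ⊎ LowerPattern v) ∎
      where
      R1≡3 : R v 1 ≡ 3
      R1≡3 = proj₁ (proj₂ (full-swaps v f))
      R0≡2 : R v 0 ≡ 2
      R0≡2 = proj₁ (full-swaps v f)
    by-mask (no nf) = begin
      Y (suc p) (c i + 1) < Y (suc p) (c i + 0)   ≡⟨ cong₂ _<_ (Y-local i 1) (Y-local i 0) ⟩
      Y p (c i + R v 1) < Y p (c i + R v 0)       ≈⟨ window-order i (R v 1) (R v 0) (localProd-keeps 4 v 1 (s≤s z≤n))
                                                       (localProd-keeps 4 v 0 z≤n) (λ _ _ → av) both-high ⟩
      R v 1 < R v 0                               ≈⟨ mk⇔ (proj₁ (proj₂ law)) (proj₂ (proj₂ law)) ⟩
      LowerPattern v                              ≈⟨ right-only (nf ∘ proj₁) ⟨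
      ((Full v × Inverted p (j i)) ⊎ LowerPattern v) ∎
      where
      law : (R v 0 ≤ 1 ⊎ R v 1 ≤ 1) × (R v 1 < R v 0 → LowerPattern v) × (LowerPattern v → R v 1 < R v 0)
      law = lowerLaw v nf
      both-high : 2 ≤ R v 1 → 2 ≤ R v 0 → Avoid p (suc (j i))
      both-high 2≤R1 2≤R0 = ⊥-elim ([ (λ R0≤1 → <⇒≱ 2≤R0 R0≤1) , (λ R1≤1 → <⇒≱ 2≤R1 R1≤1) ]′ (proj₁ law))

  -- This is the recursive description of the chains in the conditions ←C and C.
  data Reach (next : ℕ → ℕ → Set) (Pat : Vec Bool 4 → Set) : ℕ → ℕ → Set where
    reach : ∀ {K p} (m : Fin l) → toℕ m < p → next (j m) K →
            (Full (x m) × Reach next Pat (j m) (toℕ m)) ⊎ Pat (x m) → Reach next Pat K p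

  module _ {next : ℕ → ℕ → Set} {Pat : Vec Bool 4 → Set} where

    reach-skip : ∀ i K → ¬ next (j i) K → Reach next Pat K (suc (toℕ i)) ⇔ Reach next Pat K (toℕ i)
    reach-skip i K ¬next = mk⇔ earlier (λ { (reach m m<i nx w) → reach m (≤-trans m<i (n≤1+n _)) nx w })
      where
      earlier : Reach next Pat K (suc (toℕ i)) → Reach next Pat K (toℕ i)
      earlier (reach m m<i+1 nx w) with m<1+n⇒m<n∨m≡n m<i+1
      ... | inj₁ m<i  = reach m m<i nx w
      ... | inj₂ m≡i with toℕ-injective m≡i
      ...   | refl = ⊥-elim (¬next nx)

    reach-last : (∀ {a a′ K} → next a K → next a′ K → a ≡ a′) →
                 ∀ i K → next (j i) K →
                 Reach next Pat K (suc (toℕ i)) ⇔ ((Full (x i) × Reach next Pat (j i) (toℕ i)) ⊎ Pat (x i))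
    reach-last next-unique i K nx = mk⇔ last (reach i ≤-refl nx)
      where
      last : Reach next Pat K (suc (toℕ i)) → (Full (x i) × Reach next Pat (j i) (toℕ i)) ⊎ Pat (x i)
      last (reach m m<i+1 nxm w) with m<1+n⇒m<n∨m≡n m<i+1
      ... | inj₁ m<i  = ⊥-elim (avoid-self i m m<i (next-unique nxm nx))
      ... | inj₂ m≡i with toℕ-injective m≡i
      ...   | refl = w

  UpperReach LowerReach : ℕ → ℕ → Set
  UpperReach = Reach (λ a K → suc a ≡ K) UpperPattern
  LowerReach = Reach (λ a K → a ≡ suc K) LowerPattern

  upper-inversions : ∀ p → p ≤ l → ∀ q → Avoid p (suc q) → Inverted p q ⇔ UpperReach (suc q) p
  upper-inversions = prefix-induction (λ p → ∀ q → Avoid p (suc q) → Inverted p q ⇔ UpperReach (suc q) p)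
    (λ q _ → ⊥⇔⊥ (λ 1<0 → <⇒≱ 1<0 (+-monoʳ-≤ (lo q) z≤n)) (λ { (reach m () _ _) }))
    step
    where
    step : ∀ (i : Fin l) → (∀ q → Avoid (toℕ i) (suc q) → Inverted (toℕ i) q ⇔ UpperReach (suc q) (toℕ i)) →
           ∀ q → Avoid (suc (toℕ i)) (suc q) → Inverted (suc (toℕ i)) q ⇔ UpperReach (suc q) (suc (toℕ i))
    step i ih q av = by-block (j i ≟ q)
      where
      open ⇔-Reasoning
      p : ℕ
      p = toℕ i
      by-block : Dec (j i ≡ q) → Inverted (suc p) q ⇔ UpperReach (suc q) (suc p)
      by-block (yes refl) = begin
        Inverted (suc p) (j i)                         ≡⟨ cong₂ (λ a₁ a₂ → Y (suc p) a₁ < Y (suc p) a₂) (lo-next i 1) (lo-next i 0) ⟩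
        Y (suc p) (c i + 3) < Y (suc p) (c i + 2)      ≈⟨ upper-after i (avoid-earlier i av) ⟩
        ((Full (x i) × Inverted p (b i)) ⊎ UpperPattern (x i))
          ≈⟨ (⇔.refl ×-⇔ ih (b i) (subst (Avoid p) (j≡suc-b i) (avoid-self i))) ⊎-⇔ ⇔.refl ⟩
        ((Full (x i) × UpperReach (suc (b i)) p) ⊎ UpperPattern (x i))
          ≡⟨ cong (λ J → (Full (x i) × UpperReach J p) ⊎ UpperPattern (x i)) (j≡suc-b i) ⟨
        ((Full (x i) × UpperReach (j i) p) ⊎ UpperPattern (x i))
          ≈⟨ reach-last predecessor-unique i (suc (j i)) refl ⟨
        UpperReach (suc (j i)) (suc p)                 ∎
        where
        predecessor-unique : ∀ {a a′ K} → suc a ≡ K → suc a′ ≡ K → a ≡ a′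
        predecessor-unique refl e = suc-injective (sym e)
      by-block (no ji≢q) = begin
        Inverted (suc p) q                             ≡⟨ cong₂ _<_ (Y-step i _) (Y-step i _) ⟩
        Y p (blockProd 4 (j i) (x i) (lo q + 1)) < Y p (blockProd 4 (j i) (x i) (lo q + 0))
          ≡⟨ cong₂ (λ a₁ a₂ → Y p a₁ < Y p a₂) (block-fix i q ji≢q (avoid-here i av) 1 (s≤s z≤n))
                                               (block-fix i q ji≢q (avoid-here i av) 0 z≤n) ⟩
        Inverted p q                                   ≈⟨ ih q (avoid-earlier i av) ⟩
        UpperReach (suc q) p                           ≈⟨ reach-skip i (suc q) (ji≢q ∘ suc-injective) ⟨
        UpperReach (suc q) (suc p)                     ∎

  lower-inversions : ∀ p → p ≤ l → ∀ K → Avoid p K → Inverted p K ⇔ LowerReach K p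
  lower-inversions = prefix-induction (λ p → ∀ K → Avoid p K → Inverted p K ⇔ LowerReach K p)
    (λ K _ → ⊥⇔⊥ (λ 1<0 → <⇒≱ 1<0 (+-monoʳ-≤ (lo K) z≤n)) (λ { (reach m () _ _) }))
    step
    where
    step : ∀ (i : Fin l) → (∀ K → Avoid (toℕ i) K → Inverted (toℕ i) K ⇔ LowerReach K (toℕ i)) →
           ∀ K → Avoid (suc (toℕ i)) K → Inverted (suc (toℕ i)) K ⇔ LowerReach K (suc (toℕ i))
    step i ih K av = by-block (j i ≟ suc K)
      where
      open ⇔-Reasoning
      p : ℕ
      p = toℕ i
      hit : K ≡ b i → Inverted (suc p) K ⇔ LowerReach K (suc p)
      hit refl = begin
        Inverted (suc p) (b i)                         ≈⟨ lower-after i (avoid-earlier i av) ⟩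
        ((Full (x i) × Inverted p (j i)) ⊎ LowerPattern (x i))
          ≈⟨ (⇔.refl ×-⇔ ih (j i) (avoid-self i)) ⊎-⇔ ⇔.refl ⟩
        ((Full (x i) × LowerReach (j i) p) ⊎ LowerPattern (x i))
          ≈⟨ reach-last successor-unique i (b i) (j≡suc-b i) ⟨
        LowerReach (b i) (suc p)                       ∎
        where
        successor-unique : ∀ {a a′ K} → a ≡ suc K → a′ ≡ suc K → a ≡ a′
        successor-unique e e′ = trans e (sym e′)
      by-block : Dec (j i ≡ suc K) → Inverted (suc p) K ⇔ LowerReach K (suc p)
      by-block (yes ji≡K+1) = hit (suc-injective (trans (sym ji≡K+1) (j≡suc-b i)))
      by-block (no ji≢K+1) = begin
        Inverted (suc p) K                             ≡⟨ cong₂ _<_ (Y-step i _) (Y-step i _) ⟩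
        Y p (blockProd 4 (j i) (x i) (lo K + 1)) < Y p (blockProd 4 (j i) (x i) (lo K + 0))
          ≡⟨ cong₂ (λ a₁ a₂ → Y p a₁ < Y p a₂) (block-fix i K (avoid-here i av) ji≢K+1 1 (s≤s z≤n))
                                               (block-fix i K (avoid-here i av) ji≢K+1 0 z≤n) ⟩
        Inverted p K                                   ≈⟨ ih K (avoid-earlier i av) ⟩
        LowerReach K p                                 ≈⟨ reach-skip i K ji≢K+1 ⟨
        LowerReach K (suc p)                           ∎

  -- The chains in the
  -- definitions of ←N and →N are runs with non-full ends.
  record Run (Step : Fin l → Fin l → Set) (a e : Fin l) : Set where
    field
      len   : ℕ
      seq   : ℕ → Fin l
      start : seq 0 ≡ a
      end   : seq len ≡ e
      step  : ∀ k → k < len → Step (seq k) (seq (suc k))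
      inner : ∀ k → 1 ≤ k → k < len → Full (x (seq k))
      rise  : ∀ k → 1 ≤ k → k ≤ len → j (seq k) ≡ j a + k

  Ascending Descending : Fin l → Fin l → Set
  Ascending  u w = u Fin.< w
  Descending u w = w Fin.< u

  stay : ∀ {Step} a → Run Step a a
  stay a = record
    { len = 0 ; seq = λ _ → a ; start = refl ; end = refl
    ; step = λ _ () ; inner = λ _ _ () ; rise = λ { zero () _ ; (suc k) _ () } }

  prepend : ∀ {Step a m e} → Step a m → j m ≡ suc (j a) → (R : Run Step m e) →
            (0 < Run.len R → Full (x m)) → Run Step a e
  prepend {Step} {a} {m} a→m jm≡ R full-m = record
    { len = suc len ; seq = seq′ ; start = refl ; end = end
    ; step = step′ ; inner = inner′ ; rise = rise′ }
    where
    open Run R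
    seq′ : ℕ → Fin l
    seq′ zero    = a
    seq′ (suc k) = seq k
    step′ : ∀ k → k < suc len → Step (seq′ k) (seq′ (suc k))
    step′ zero    _           = subst (Step a) (sym start) a→m
    step′ (suc k) (s≤s k<len) = step k k<len
    inner′ : ∀ k → 1 ≤ k → k < suc len → Full (x (seq′ k))
    inner′ (suc zero)    _ (s≤s 0<len)   = subst (Full ∘ x) (sym start) (full-m 0<len)
    inner′ (suc (suc k)) _ (s≤s k+1<len) = inner (suc k) (s≤s z≤n) k+1<len
    rise′ : ∀ k → 1 ≤ k → k ≤ suc len → j (seq′ k) ≡ j a + k
    rise′ (suc zero)    _ _ = trans (cong j start) (trans jm≡ (+-comm 1 (j a)))
    rise′ (suc (suc k)) _ (s≤s k+1≤len) = begin
      j (seq (suc k))      ≡⟨ rise (suc k) (s≤s z≤n) k+1≤len ⟩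
      j m + suc k          ≡⟨ cong (_+ suc k) jm≡ ⟩
      suc (j a) + suc k    ≡⟨ +-suc (j a) (suc k) ⟨
      j a + suc (suc k)    ∎
      where open ≡-Reasoning

  NonEmpty : ∀ {Step a e} → Run Step a e → Set
  NonEmpty R = 0 < Run.len R

  upper-run : ∀ {K p} → UpperReach K p → ∀ e → j e ≡ K → toℕ e ≡ p →
              ∀ {z} (acc : Run Ascending e z) → (NonEmpty acc → Full (x e)) →
              ∃ λ r → UpperPattern (x r) × Σ (Run Ascending r z) NonEmpty
  upper-run (reach m m<p jm+1≡K w) e je≡K te≡p {z} acc full-e = continue w
    where
    acc′ : Run Ascending m z
    acc′ = prepend (subst (toℕ m <_) (sym te≡p) m<p) (trans je≡K (sym jm+1≡K)) acc full-e
    continue : (Full (x m) × UpperReach (j m) (toℕ m)) ⊎ UpperPattern (x m) →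
               ∃ λ r → UpperPattern (x r) × Σ (Run Ascending r z) NonEmpty
    continue (inj₂ pat)             = m , pat , acc′ , s≤s z≤n
    continue (inj₁ (full-m , rest)) = upper-run rest m refl refl acc′ (λ _ → full-m)

  lower-run : ∀ {K p} → LowerReach K p → ∀ e → j e ≡ K → toℕ e ≡ p →
              ∃ λ r → LowerPattern (x r) × Σ (Run Descending e r) NonEmpty
  lower-run (reach m m<p jm≡K+1 w) e je≡K te≡p = continue w
    where
    e→m : Descending e m
    e→m = subst (toℕ m <_) (sym te≡p) m<p
    jm≡ : j m ≡ suc (j e)
    jm≡ = trans jm≡K+1 (cong suc (sym je≡K))
    continue : (Full (x m) × LowerReach (j m) (toℕ m)) ⊎ LowerPattern (x m) →
               ∃ λ r → LowerPattern (x r) × Σ (Run Descending e r) NonEmpty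
    continue (inj₂ pat) = m , pat , prepend e→m jm≡ (stay m) (λ ()) , s≤s z≤n
    continue (inj₁ (full-m , rest)) with lower-run rest m refl refl
    ... | r , pat , R , _ = r , pat , prepend e→m jm≡ R (λ _ → full-m) , s≤s z≤n

  consecutive : ∀ {a t} (seq : ℕ → Fin l) → seq 0 ≡ a → (∀ k → 1 ≤ k → k ≤ t → j (seq k) ≡ j a + k) →
                ∀ k → k < t → j (seq (suc k)) ≡ suc (j (seq k))
  consecutive {a} {t} seq start jval k k<t =
    trans (jval (suc k) (s≤s z≤n) k<t) (trans (+-suc (j a) k) (cong suc (sym (jval₀ k (<⇒≤ k<t)))))
    where
    jval₀ : ∀ k → k ≤ t → j (seq k) ≡ j a + k
    jval₀ zero    _ = trans (cong j start) (sym (+-identityʳ (j a)))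
    jval₀ (suc k) = jval (suc k) (s≤s z≤n)

  Cback⇔UpperReach : ∀ i → ¬ Full (x i) → Cback j x i ⇔ UpperReach (j i) (toℕ i)
  Cback⇔UpperReach i nf = mk⇔ from-chain to-chain
    where
    from-chain : Cback j x i → UpperReach (j i) (toℕ i)
    from-chain (r , chain , pat) = subst (λ z → UpperReach (j z) (toℕ z)) end (at-end t t>0 along)
      where
      open RightChain chain
      at-end : ∀ n → 0 < n → (∀ k → k < n → UpperReach (j (seq (suc k))) (toℕ (seq (suc k)))) →
               UpperReach (j (seq n)) (toℕ (seq n))
      at-end (suc n) _ reaches = reaches n ≤-refl
      along : ∀ k → k < t → UpperReach (j (seq (suc k))) (toℕ (seq (suc k)))
      along zero    k<t = reach (seq 0) (mono 0 k<t) (sym (consecutive seq start jval 0 k<t))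
                                (inj₂ (subst (UpperPattern ∘ x) (sym start) pat))
      along (suc k) k<t = reach (seq (suc k)) (mono (suc k) k<t) (sym (consecutive seq start jval (suc k) k<t))
                                (inj₁ (inA (suc k) (s≤s z≤n) k<t , along k (<⇒≤ k<t)))
    to-chain : UpperReach (j i) (toℕ i) → Cback j x i
    to-chain ur with upper-run ur i refl refl (stay i) (λ ())
    ... | r , pat , R , nonempty = r , chain , pat
      where
      open Run R
      chain : RightChain j (InIf x) r i
      chain = record
        { notIn = λ full-r → full-not-upper (x r) full-r pat ; t = len ; t>0 = nonempty ; seq = seq
        ; start = start ; mono = step ; inA = inner ; lastOut = subst (¬_ ∘ Full ∘ x) (sym end) nf
        ; jval = rise ; end = end }

  C⇔LowerReach : ∀ i → ¬ Full (x i) → C j x i ⇔ LowerReach (j i) (toℕ i)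
  C⇔LowerReach i nf = mk⇔ from-chain to-chain
    where
    from-chain : C j x i → LowerReach (j i) (toℕ i)
    from-chain (r , chain , pat) = subst (λ z → LowerReach (j z) (toℕ z)) start (at-start t t>0 back)
      where
      open LeftChain chain
      at-start : ∀ n → 0 < n → (∀ d k → k + suc d ≡ n → LowerReach (j (seq k)) (toℕ (seq k))) →
                 LowerReach (j (seq 0)) (toℕ (seq 0))
      at-start (suc d) _ reaches = reaches d 0 refl
      back : ∀ d k → k + suc d ≡ t → LowerReach (j (seq k)) (toℕ (seq k))
      back zero k k+1≡t = reach (seq (suc k)) (mono k k<t) (consecutive seq start jval k k<t)
                                (inj₂ (subst (LowerPattern ∘ x) (sym (trans (cong seq (trans (+-comm 1 k) k+1≡t)) end)) pat))
        where
        k<t : k < t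
        k<t = subst (k <_) k+1≡t (m<m+n k z<s)
      back (suc d) k k+d+2≡t = reach (seq (suc k)) (mono k k<t) (consecutive seq start jval k k<t)
                                     (inj₁ (inA (suc k) (s≤s z≤n) k+1<t , back d (suc k) (trans (sym (+-suc k (suc d))) k+d+2≡t)))
        where
        k+1<t : suc k < t
        k+1<t = subst (suc k <_) (trans (sym (+-suc k (suc d))) k+d+2≡t) (m<m+n (suc k) z<s)
        k<t : k < t
        k<t = <-trans (n<1+n k) k+1<t
    to-chain : LowerReach (j i) (toℕ i) → C j x i
    to-chain lr with lower-run lr i refl refl
    ... | r , pat , R , nonempty = r , chain , pat
      where
      open Run R
      chain : LeftChain j (InIf x) i r
      chain = record
        { notIn = nf ; t = len ; t>0 = nonempty ; seq = seq
        ; start = start ; mono = step ; inA = inner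
        ; lastOut = subst (¬_ ∘ Full ∘ x) (sym end) (λ full-r → full-not-lower (x r) full-r pat)
        ; jval = rise ; end = end }

  lower-pair-before : ∀ i → ¬ Full (x i) → (Y (toℕ i) (c i + 1) < Y (toℕ i) (c i + 0)) ⇔ Cback j x i
  lower-pair-before i nf = begin
    Inverted (toℕ i) (b i)            ≈⟨ upper-inversions (toℕ i) (<⇒≤ (toℕ<n i)) (b i) avoid-ji ⟩
    UpperReach (suc (b i)) (toℕ i)    ≡⟨ cong (λ J → UpperReach J (toℕ i)) (j≡suc-b i) ⟨
    UpperReach (j i) (toℕ i)          ≈⟨ Cback⇔UpperReach i nf ⟨
    Cback j x i                       ∎
    where
    open ⇔-Reasoning
    avoid-ji : Avoid (toℕ i) (suc (b i))
    avoid-ji = subst (Avoid (toℕ i)) (j≡suc-b i) (avoid-self i)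

  upper-pair-before : ∀ i → ¬ Full (x i) → (Y (toℕ i) (c i + 3) < Y (toℕ i) (c i + 2)) ⇔ C j x i
  upper-pair-before i nf = begin
    Y (toℕ i) (c i + 3) < Y (toℕ i) (c i + 2)  ≡⟨ cong₂ (λ a₁ a₂ → Y (toℕ i) a₁ < Y (toℕ i) a₂) (lo-next i 1) (lo-next i 0) ⟨
    Inverted (toℕ i) (j i)             ≈⟨ lower-inversions (toℕ i) (<⇒≤ (toℕ<n i)) (j i) (avoid-self i) ⟩
    LowerReach (j i) (toℕ i)           ≈⟨ C⇔LowerReach i nf ⟨
    C j x i                            ∎
    where open ⇔-Reasoning

  π-window : ∀ k i δ {a} → k ≤ 4 → a ≡ c i + δ → π j x (4 * toℕ i + k) a ≡ Y (toℕ i) (c i + localProd k (x i) δ)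
  π-window k i δ k≤4 refl = trans (π-split j x i k k≤4 _) (cong (Y (toℕ i)) (blockLocalᵢ k i δ))

-- (1) holds as the earlier blocks preserve the cut at 2j_i; for (2)-(4), π_{4p+k} on the
-- roots is read in the window of block i, and InsideBlock applies with the descriptions
-- of the inverted lower and upper pairs before block i.
lemma4p3 : (n l : ℕ) (j : Fin l → ℕ)
    → (∀ i → 1 ≤ j i) → (∀ i → j i + 1 ≤ n)
    → Injective _≡_ _≡_ j
    → (x : Mask l) → (i : Fin l)
    → Positive (act (π j x (4 * toℕ i)) (α (2 * j i)))
      × (Negative (act (π j x (4 * toℕ i + 1)) (α (2 * j i ∸ 1)))
          ⇔ (lookup (x i) Fin.zero ≡ false × Cback j x i))
      × (Negative (act (π j x (4 * toℕ i + 2)) (α (2 * j i + 1)))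
          ⇔ (lookup (x i) Fin.zero ≡ false × C j x i))
      × (Negative (act (π j x (4 * toℕ i + 3)) (α (2 * j i)))
          ⇔ ExactlyOne (x i matches (b1 ∷ b0 ∷ b0 ∷ ⋆ ∷ []))
                       (x i matches (b1 ∷ b0 ∷ b1 ∷ ⋆ ∷ []) × C j x i)
                       (x i matches (b1 ∷ b1 ∷ b0 ∷ ⋆ ∷ []) × Cback j x i))
lemma4p3 n l j j≥1 _ j-inj x i =
    subst₂ (λ a₁ a₂ → Y p a₁ < Y p a₂) (sym (2j≡ i)) (sym (next (2j≡ i))) (separated 1 2 (s≤s z≤n) ≤-refl)
  , via (cong₂ _<_ (π-window 1 i 1 1≤4 (next (2j-1≡ i))) (π-window 1 i 0 1≤4 (2j-1≡ i)))
        (after₁ (x i) (lower-pair-before i))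
  , via (cong₂ _<_ (π-window 2 i 3 2≤4 (next (2j+1≡ i))) (π-window 2 i 2 2≤4 (2j+1≡ i)))
        (after₂ (x i) (upper-pair-before i))
  , via (cong₂ _<_ (π-window 3 i 2 3≤4 (next (2j≡ i))) (π-window 3 i 1 3≤4 (2j≡ i)))
        (after₃ (x i) (lower-pair-before i) (upper-pair-before i))
  where
  open Prefixes j x j≥1 j-inj
  p : ℕ
  p = toℕ i
  open InsideBlock (Y p) (c i) (cut-before i)
  next : ∀ {a d} → a ≡ c i + d → suc a ≡ c i + suc d
  next {d = d} a≡ = trans (cong suc a≡) (sym (+-suc (c i) d))
  1≤4 : 1 ≤ 4
  1≤4 = s≤s z≤n
  2≤4 : 2 ≤ 4
  2≤4 = s≤s (s≤s z≤n)
  3≤4 : 3 ≤ 4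
  3≤4 = s≤s (s≤s (s≤s z≤n))
  via : ∀ {A B D : Set} → A ≡ B → B ⇔ D → A ⇔ D
  via refl B⇔D = B⇔D
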